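{- Let $\mathbb{K}=(G,M,I)$ be a formal context and $\mathbb{S}=[H,N]$ a subcontext of $\mathbb{K}$. Then $\mathbb{S}$ is a closed-subcontext of $\mathbb{K}$ if and only if $\phi_1(C)=\phi_2(C)=C$ for all formal concepts $C$ of $\mathbb{S}$.
   Context: All sets are finite. A formal context $\mathbb{K}=(G,M,I)$ has finite $G$, $M$, $I\subseteq G\times M$; for $A\subseteq G$, $A'$ is the set of attributes common to all objects of $A$, for $B\subseteq M$, $B'$ the set of objects having all attributes of $B$. Formal concepts $(A,B)$ satisfy $A'=B$, $B'=A$. For $H\subseteq G$, $N\subseteq M$, the subcontext $[H,N]$ is $(H,N,I\cap(H\times N))$, with concepts computed w.r.t. its own incidence. A formal context $(H,N,J)$ is a closed-subcontext of $\mathbb{K}$ iff $H\subseteq G$, $N\subseteq M$, $J\subseteq I\cap(H\times N)$, and every concept of $(H,N,J)$ is a concept of $\mathbb{K}$. For a concept $(A,B)$ of $[H,N]$, $\phi_1(A,B)=(A'',A')$ and $\phi_2(A,B)=(B',B'')$, derivations in $\mathbb{K}$. -}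

module Defs where

open import Data.Nat using (ℕ; zero; suc)
open import Data.Bool using (Bool; true; false; _∧_; _∨_; not)
open import Data.Fin using (Fin; zero; suc)
open import Data.Fin.Subset using (Subset; ⊤; _⊆_)
open import Data.Vec using (lookup; tabulate)
open import Data.Product using (_×_; _,_)
open import Relation.Binary.PropositionalEquality using (_≡_)

-- A formal context with object set G = Fin g, attribute set M = Fin m,
-- and incidence I given by its (Boolean) characteristic function.
Incidence : ℕ → ℕ → Set
Incidence g m = Fin g → Fin m → Bool

allFin : {n : ℕ} → (Fin n → Bool) → Bool
allFin {zero}  p = true
allFin {suc n} p = p zero ∧ allFin (λ i → p (suc i))

-- Derivation operators of a context (H, N, J) whose object set is H ⊆ Fin g
-- and attribute set is N ⊆ Fin m (objects / attributes outside H, N are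
-- not part of that context).
up : {g m : ℕ} → Subset m → Incidence g m → Subset g → Subset m
up N J A = tabulate λ y → lookup N y ∧ allFin (λ x → not (lookup A x) ∨ J x y)

down : {g m : ℕ} → Subset g → Incidence g m → Subset m → Subset g
down H J B = tabulate λ x → lookup H x ∧ allFin (λ y → not (lookup B y) ∨ J x y)

IsConcept : {g m : ℕ} → Subset g → Subset m → Incidence g m →
            Subset g → Subset m → Set
IsConcept H N J A B = (A ⊆ H) × (B ⊆ N) × (up N J A ≡ B) × (down H J B ≡ A)

IsConceptK : {g m : ℕ} → Incidence g m → Subset g → Subset m → Set
IsConceptK I A B = IsConcept ⊤ ⊤ I A B

restrict : {g m : ℕ} → Incidence g m → Subset g → Subset m → Incidence g m
restrict I H N x y = lookup H x ∧ lookup N y ∧ I x y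

-- (H, N, J) is a closed-subcontext of K = (G, M, I)
-- (H ⊆ G and N ⊆ M hold by typing).
IsClosedSubcontext : {g m : ℕ} → Incidence g m →
                     Subset g → Subset m → Incidence g m → Set
IsClosedSubcontext I H N J =
  (∀ x y → J x y ≡ true → restrict I H N x y ≡ true) ×
  (∀ A B → IsConcept H N J A B → IsConceptK I A B)

φ₁ : {g m : ℕ} → Incidence g m → Subset g × Subset m → Subset g × Subset m
φ₁ I (A , B) = (down ⊤ I (up ⊤ I A) , up ⊤ I A)

φ₂ : {g m : ℕ} → Incidence g m → Subset g × Subset m → Subset g × Subset m
φ₂ I (A , B) = (down ⊤ I B , up ⊤ I (down ⊤ I B))

-- A pair (A, B) is a concept of K exactly when A' = B and B' = A in K, and
-- these two equations are precisely the second and first components of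
-- φ₁(A, B) = (A, B) and φ₂(A, B) = (A, B); conversely they give back
-- A'' = A and B'' = B. The incidence condition of a closed-subcontext is
-- automatic for the restricted incidence I ∩ (H × N).
module Submission where

open import Defs
open import Data.Nat using (ℕ)
open import Data.Fin.Subset using (Subset; ⊤)
open import Data.Fin.Subset.Properties using (⊆⊤)
open import Data.Product using (_×_; _,_; proj₁; proj₂)
open import Function.Bundles using (_⇔_; mk⇔)
open import Relation.Binary.PropositionalEquality using (_≡_; refl; cong; cong₂; trans)

IsFixedByφ : {g m : ℕ} → Incidence g m → Subset g → Subset m → Set
IsFixedByφ I A B = (φ₁ I (A , B) ≡ (A , B)) × (φ₂ I (A , B) ≡ (A , B))

conceptK⇒fixedByφ : {g m : ℕ} (I : Incidence g m) {A : Subset g} {B : Subset m} →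
  IsConceptK I A B → IsFixedByφ I A B
conceptK⇒fixedByφ I (_ , _ , A′≡B , B′≡A) =
  cong₂ _,_ (trans (cong (down ⊤ I) A′≡B) B′≡A) A′≡B ,
  cong₂ _,_ B′≡A (trans (cong (up ⊤ I) B′≡A) A′≡B)

fixedByφ⇒conceptK : {g m : ℕ} (I : Incidence g m) {A : Subset g} {B : Subset m} →
  IsFixedByφ I A B → IsConceptK I A B
fixedByφ⇒conceptK I {A} {B} (φ₁-fix , φ₂-fix) =
  (λ {x} → ⊆⊤ {p = A} {x = x}) , (λ {y} → ⊆⊤ {p = B} {x = y}) ,
  cong proj₂ φ₁-fix , cong proj₁ φ₂-fix

lemma18 : {g m : ℕ} (I : Incidence g m) (H : Subset g) (N : Subset m) →
    IsClosedSubcontext I H N (restrict I H N) ⇔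
      (∀ A B → IsConcept H N (restrict I H N) A B →
        (φ₁ I (A , B) ≡ (A , B)) × (φ₂ I (A , B) ≡ (A , B)))
lemma18 I H N = mk⇔
  (λ (_ , concepts-closed) A B c → conceptK⇒fixedByφ I (concepts-closed A B c))
  (λ fixed → (λ _ _ J≡true → J≡true) ,
             (λ A B c → fixedByφ⇒conceptK I (fixed A B c)))
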